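{- Let $G$ be a finite group with faithful primitive actions on finite sets $\Omega_1$ and $\Omega_2$. If the O'Nan–Scott type of the action on $\Omega_1$ is HA, HS, HC or AS, then the type of the action on $\Omega_2$ is the same type. If the type on $\Omega_1$ is TW, then the type on $\Omega_2$ is one of TW, SD, CD, PA; if it is SD, then the type on $\Omega_2$ is one of TW, SD, PA; if it is CD, then the type on $\Omega_2$ is one of TW, CD, PA; if it is PA, then the type on $\Omega_2$ is one of TW, SD, CD, PA.
   Context: Primitive groups $G$ on $\Omega$ are divided into eight O'Nan–Scott types (Praeger), with $T$ a nonabelian simple group and $\alpha\in\Omega$: HA: the unique minimal normal subgroup is elementary abelian and regular. HS: two minimal normal subgroups, each nonabelian simple and regular. HC: two minimal normal subgroups, each isomorphic to $T^k$ with $k\ge 2$ and regular. AS: the unique minimal normal subgroup is nonabelian simple. TW: the unique minimal normal subgroup is regular and isomorphic to $T^k$ with $k\ge 6$. SD: the unique minimal normal subgroup $N\cong T^k$, $k\ge2$, with $N_\alpha$ a full diagonal subgroup of $N$, and $G$ acts primitively on the $k$ simple direct factors of $N$. CD: the unique minimal normal subgroup $N\cong T^k$ with $N_\alpha\cong T^\ell$ a direct product of $\ell$ pairwise disjoint full strips of length $k/\ell$, $\ell,k/\ell\ge 2$, and the supports of these strips form a system of imprimitivity for $G$ on the $k$ simple direct factors. PA: the unique minimal normal subgroup $N\cong T^k$, $k\ge 2$, with $N_\alpha\cong R^k$ for a proper nontrivial subgroup $R$ of $T$. Here, with $\pi_i$ the projection of $N=T^k$ onto its $i$-th factor, a full strip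 is a subgroup $M\cong T$ with each $\pi_i(M)$ equal to $T$ or trivial; its support is $\{i:\pi_i(M)\cong T\}$, its length the size of the support; strips are disjoint if their supports are; a full diagonal subgroup is a full strip of length $k$. -}

module Defs where

open import Level using (0ℓ)
open import Algebra.Bundles using (Group)
open import Data.Nat using (ℕ; _≤_; _*_)
open Data.Nat using (zero; suc)
open import Data.Nat.Primality using (Prime)
open import Data.Fin using (Fin; zero; suc) renaming (_≟_ to _≟ᶠ_)
open import Data.Fin.Subset using (Subset; _∈_; _∉_; ∣_∣)
open import Data.Vec using (tabulate)
open import Data.Bool using (if_then_else_)
open import Data.Product using (Σ; ∃; ∃-syntax; _×_)
open import Data.Sum using (_⊎_)
open import Data.Unit using (⊤)
open import Data.Empty using (⊥)
open import Relation.Nullary using (¬_; does)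
open import Relation.Binary.PropositionalEquality using (_≡_)

Group₀ : Set₁
Group₀ = Group 0ℓ 0ℓ

module GroupNotions (G : Group₀) where
  open Group G

  IsFiniteGroup : Set
  IsFiniteGroup = Σ ℕ λ n → Σ (Fin n → Carrier) λ f → ∀ g → ∃[ i ] (f i ≈ g)

  Sub : Set₁
  Sub = Carrier → Set

  _⊆_ : Sub → Sub → Set
  H ⊆ K = ∀ x → H x → K x

  IsSubgroup : Sub → Set
  IsSubgroup H = (∀ x y → x ≈ y → H x → H y)
               × H ε
               × (∀ x y → H x → H y → H (x ∙ y))
               × (∀ x → H x → H (x ⁻¹))

  Trivial : Sub → Set
  Trivial H = ∀ x → H x → x ≈ ε

  IsNormal : Sub → Set
  IsNormal H = IsSubgroup H × (∀ g x → H x → H (g ∙ x ∙ g ⁻¹))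

  IsMinimalNormal : Sub → Set₁
  IsMinimalNormal N = IsNormal N × ¬ Trivial N
                    × (∀ M → IsNormal M → M ⊆ N → Trivial M ⊎ N ⊆ M)

  SameSub : Sub → Sub → Set
  SameSub H K = H ⊆ K × K ⊆ H

  UniqueMinimalNormal : Sub → Set₁
  UniqueMinimalNormal N = IsMinimalNormal N × (∀ M → IsMinimalNormal M → SameSub M N)

  ExactlyTwoMinimalNormal : Sub → Sub → Set₁
  ExactlyTwoMinimalNormal N₁ N₂ =
    IsMinimalNormal N₁ × IsMinimalNormal N₂ × ¬ SameSub N₁ N₂
    × (∀ M → IsMinimalNormal M → SameSub M N₁ ⊎ SameSub M N₂)

  AbelianSub : Sub → Set
  AbelianSub H = ∀ x y → H x → H y → x ∙ y ≈ y ∙ x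

  pow : Carrier → ℕ → Carrier
  pow x zero    = ε
  pow x (suc m) = x ∙ pow x m

  ElementaryAbelian : Sub → Set
  ElementaryAbelian H = AbelianSub H × Σ ℕ λ p → Prime p × (∀ x → H x → pow x p ≈ ε)

  SimpleSub : Sub → Set₁
  SimpleSub H = IsSubgroup H × ¬ Trivial H
              × (∀ M → IsSubgroup M → M ⊆ H → (∀ x y → H x → M y → M (x ∙ y ∙ x ⁻¹))
                   → Trivial M ⊎ H ⊆ M)

  NonabelianSimpleSub : Sub → Set₁
  NonabelianSimpleSub H = SimpleSub H × ¬ AbelianSub H

  -- ψ : A → G is an isomorphism from the subgroup D of the group (A,≈A,·)
  -- onto the subgroup H of G
  IsIsoOnto : {A : Set} (_≈A_ : A → A → Set) (_·_ : A → A → A) (D : A → Set)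
              (ψ : A → Carrier) (H : Sub) → Set
  IsIsoOnto _≈A_ _·_ D ψ H =
      (∀ a b → D a → D b → a ≈A b → ψ a ≈ ψ b)
    × (∀ a b → D a → D b → ψ (a · b) ≈ ψ a ∙ ψ b)
    × (∀ a b → D a → D b → ψ a ≈ ψ b → a ≈A b)
    × (∀ a → D a → H (ψ a))
    × (∀ x → H x → ∃[ a ] (D a × ψ a ≈ x))

Whole : (T : Group₀) → Group.Carrier T → Set
Whole T _ = ⊤

NonabelianSimpleGroup : Group₀ → Set₁
NonabelianSimpleGroup T = GroupNotions.NonabelianSimpleSub T (Whole T)

module PowerNotions (T : Group₀) where
  open Group T

  Tup : ℕ → Set
  Tup k = Fin k → Carrier

  _≈ᵏ_ : {k : ℕ} → Tup k → Tup k → Set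
  a ≈ᵏ b = ∀ i → a i ≈ b i

  _·ᵏ_ : {k : ℕ} → Tup k → Tup k → Tup k
  (a ·ᵏ b) i = a i ∙ b i

  δ : {k : ℕ} → Fin k → Carrier → Tup k
  δ i t j = if does (i ≟ᶠ j) then t else ε

record Action (G : Group₀) (n : ℕ) : Set where
  open Group G
  field
    act     : Carrier → Fin n → Fin n
    act-cong : ∀ g h p → g ≈ h → act g p ≡ act h p
    act-ε   : ∀ p → act ε p ≡ p
    act-∙   : ∀ g h p → act (g ∙ h) p ≡ act g (act h p)

module ActionNotions {G : Group₀} {n : ℕ} (A : Action G n) where
  open Group G
  open Action A
  open GroupNotions G

  Faithful : Set
  Faithful = ∀ g → (∀ p → act g p ≡ p) → g ≈ ε

  Transitive : Set
  Transitive = ∀ p q → ∃[ g ] (act g p ≡ q)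

  IsBlock : Subset n → Set
  IsBlock B = ∀ g → (∀ p → p ∈ B → act g p ∈ B) ⊎ (∀ p → p ∈ B → act g p ∉ B)

  Primitive : Set
  Primitive = Transitive × (∀ B → IsBlock B → ∣ B ∣ ≤ 1 ⊎ ∣ B ∣ ≡ n)

  Stab : Sub → Fin n → Sub
  Stab H α x = H x × act x α ≡ α

  Regular : Sub → Set
  Regular H = (∀ p q → ∃[ x ] (H x × act x p ≡ q))
            × (∀ x p → H x → act x p ≡ p → x ≈ ε)

record PowerStructure (G : Group₀) (N : GroupNotions.Sub G) : Set₁ where
  field
    T      : Group₀
    k      : ℕ
    T-nas  : NonabelianSimpleGroup T
    φ      : PowerNotions.Tup T k → Group.Carrier G
  open PowerNotions T public
  field
    φ-iso  : GroupNotions.IsIsoOnto G _≈ᵏ_ _·ᵏ_ (λ _ → ⊤) φ N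

module PowerStructureNotions {G : Group₀} {N : GroupNotions.Sub G}
                             (P : PowerStructure G N) where
  open Group G
  open GroupNotions G
  open PowerStructure P
  module T = Group T

  Factor : Fin k → Sub
  Factor i x = ∃[ t ] (φ (δ i t) ≈ x)

  InducesOnFactors : Action G k → Set
  InducesOnFactors σ = ∀ g i x → (Factor i x → Factor (Action.act σ g i) (g ∙ x ∙ g ⁻¹))
                                × (Factor (Action.act σ g i) x → Factor i (g ⁻¹ ∙ x ∙ g))

  -- π_i(M) = T   and   π_i(M) = 1   (π_i the i-th projection N = T^k → T)
  ProjFull : Sub → Fin k → Set
  ProjFull M i = ∀ t → ∃[ a ] (M (φ a) × a i T.≈ t)

  ProjTrivial : Sub → Fin k → Set
  ProjTrivial M i = ∀ a → M (φ a) → a i T.≈ T.ε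

  FullStrip : Sub → Set
  FullStrip M = IsSubgroup M × M ⊆ N
              × (Σ (T.Carrier → Carrier) λ ψ → IsIsoOnto T._≈_ T._∙_ (λ _ → ⊤) ψ M)
              × (∀ i → ProjFull M i ⊎ ProjTrivial M i)

  FullDiagonal : Sub → Set
  FullDiagonal M = FullStrip M × (∀ i → ProjFull M i)

prodF : (G : Group₀) {ℓ : ℕ} → (Fin ℓ → Group.Carrier G) → Group.Carrier G
prodF G {zero}  y = Group.ε G
prodF G {suc ℓ} y = Group._∙_ G (y zero) (prodF G (λ j → y (suc j)))

data ONType : Set where
  HA HS HC AS TW SD CD PA : ONType

module _ {G : Group₀} {n : ℕ} (A : Action G n) where
  open Group G
  open GroupNotions G
  open ActionNotions A

  TypeHA : Set₁
  TypeHA = Σ Sub λ N → UniqueMinimalNormal N × ElementaryAbelian N × Regular N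

  TypeHS : Set₁
  TypeHS = Σ Sub λ N₁ → Σ Sub λ N₂ → ExactlyTwoMinimalNormal N₁ N₂
         × NonabelianSimpleSub N₁ × Regular N₁
         × NonabelianSimpleSub N₂ × Regular N₂

  TypeHC : Set₁
  TypeHC = Σ Sub λ N₁ → Σ Sub λ N₂ → ExactlyTwoMinimalNormal N₁ N₂
         × (Σ (PowerStructure G N₁) λ P → 2 ≤ PowerStructure.k P) × Regular N₁
         × (Σ (PowerStructure G N₂) λ P → 2 ≤ PowerStructure.k P) × Regular N₂

  TypeAS : Set₁
  TypeAS = Σ Sub λ N → UniqueMinimalNormal N × NonabelianSimpleSub N

  TypeTW : Set₁
  TypeTW = Σ Sub λ N → UniqueMinimalNormal N × Regular N
         × (Σ (PowerStructure G N) λ P → 6 ≤ PowerStructure.k P)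

  TypeSD : Set₁
  TypeSD = Σ Sub λ N → UniqueMinimalNormal N
         × Σ (PowerStructure G N) λ P → 2 ≤ PowerStructure.k P
         × Σ (Fin n) λ α → PowerStructureNotions.FullDiagonal P (Stab N α)
         × Σ (Action G (PowerStructure.k P)) λ σ →
             PowerStructureNotions.InducesOnFactors P σ × ActionNotions.Primitive σ

  TypeCD : Set₁
  TypeCD = Σ Sub λ N → UniqueMinimalNormal N
         × Σ (PowerStructure G N) λ P →
           let k = PowerStructure.k P in
           Σ ℕ λ ℓ → Σ ℕ λ m → 2 ≤ ℓ × 2 ≤ m × ℓ * m ≡ k
         × Σ (Fin n) λ α →
           -- strips M j (j < ℓ); supp i = the strip whose support contains factor i
           Σ (Fin ℓ → Sub) λ M → Σ (Fin k → Fin ℓ) λ supp →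
               (∀ j → PowerStructureNotions.FullStrip P (M j))
             × (∀ j i → (PowerStructureNotions.ProjFull P (M j) i → supp i ≡ j)
                      × (supp i ≡ j → PowerStructureNotions.ProjFull P (M j) i))
             × (∀ j → ∣ tabulate (λ i → does (supp i ≟ᶠ j)) ∣ ≡ m)
             × (∀ x → Stab N α x → ∃[ y ] ((∀ j → M j (y j)) × x ≈ prodF G y))
             × (∀ (y : Fin ℓ → Carrier) → (∀ j → M j (y j)) → Stab N α (prodF G y))
             -- the supports form a system of imprimitivity for G on the factors
             × Σ (Action G k) λ σ → PowerStructureNotions.InducesOnFactors P σ
               × (∀ g j → ∃[ j′ ] (∀ i → supp i ≡ j → supp (Action.act σ g i) ≡ j′))

  TypePA : Set₁
  TypePA = Σ Sub λ N → UniqueMinimalNormal N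
         × Σ (PowerStructure G N) λ P →
           let open PowerStructure P in
           2 ≤ k
         × Σ (Group.Carrier T → Set) λ R →
             GroupNotions.IsSubgroup T R
           × (∃[ t ] (¬ R t))
           × (∃[ r ] (R r × ¬ Group._≈_ T r (Group.ε T)))
           × Σ (Fin n) λ α → Σ (Tup k → Carrier) λ ψ →
               IsIsoOnto _≈ᵏ_ _·ᵏ_ (λ a → ∀ i → R (a i)) ψ (Stab N α)

  HasType : ONType → Set₁
  HasType HA = TypeHA
  HasType HS = TypeHS
  HasType HC = TypeHC
  HasType AS = TypeAS
  HasType TW = TypeTW
  HasType SD = TypeSD
  HasType CD = TypeCD
  HasType PA = TypePA

Compatible : ONType → ONType → Set
Compatible HA t = t ≡ HA
Compatible HS t = t ≡ HS
Compatible HC t = t ≡ HC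
Compatible AS t = t ≡ AS
Compatible TW t = t ≡ TW ⊎ t ≡ SD ⊎ t ≡ CD ⊎ t ≡ PA
Compatible SD t = t ≡ TW ⊎ t ≡ SD ⊎ t ≡ PA
Compatible CD t = t ≡ TW ⊎ t ≡ CD ⊎ t ≡ PA
Compatible PA t = t ≡ TW ⊎ t ≡ SD ⊎ t ≡ CD ⊎ t ≡ PA

module Submission where

-- The O'Nan–Scott type is largely read off from the minimal normal subgroups of G alone: HA, AS
-- and TW/SD/CD/PA have a unique one, which is abelian, nonabelian simple, or T^k with k ≥ 2;
-- HS and HC have exactly two, both simple resp. both T^k with k ≥ 2. These descriptions are
-- mutually exclusive, since an abelian group is not T^k and T^k with k ≥ 2 is not simple.
-- What remains is SD against CD on the same N ≅ T^k. Any two such decompositions of N have the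
-- same simple direct factors: a factor of one decomposition meeting every factor of the other
-- trivially would centralise N, and a nontrivial intersection is normal in a simple factor.
-- Hence G acts on a single set of factors, primitively by SD, while by CD it preserves the
-- partition into the supports of the strips, which has at least two parts of size at least two.

open import Defs
open import Data.Nat using (ℕ; zero; suc; _≤_; s≤s; z≤n)
open import Data.Nat.Properties using (≤-trans; <⇒≤; *-mono-≤)
open import Data.Fin using (Fin; zero; suc; fromℕ<) renaming (_≟_ to _≟ᶠ_)
open import Data.Fin.Subset using (Subset; _∈_; _⊂_; ∣_∣; ⁅_⁆; Nonempty)
open import Data.Fin.Subset.Properties
  using (p⊂q⇒∣p∣<∣q∣; p⊆q⇒∣p∣≤∣q∣; ∣⁅x⁆∣≡1; x∈⁅x⁆; x∈⁅y⁆⇒x≡y; x≢y⇒x∉⁅y⁆;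
         ∣p∣≡n⇒p≡⊤; ∈⊤; nonempty?; Empty-unique; ∣⊥∣≡0)
open import Data.Vec using (tabulate)
open import Data.Vec.Properties using (lookup∘tabulate; []=⇒lookup; lookup⇒[]=)
open import Data.Bool.Properties using (T-≡)
open import Data.Product using (Σ; ∃-syntax; _×_; _,_; proj₁; proj₂)
open import Data.Sum using (_⊎_; inj₁; inj₂; [_,_]′)
open import Data.Unit using (⊤; tt)
open import Data.Empty using (⊥; ⊥-elim)
open import Function.Bundles using (Equivalence)
open import Relation.Nullary using (¬_; yes; no; does; contradiction)
open import Relation.Nullary.Decidable using (dec-true; toWitness; isYes≗does)
open import Relation.Binary.PropositionalEquality as ≡ using (_≡_; _≢_; subst; subst₂)
open import Algebra.Bundles using (Group)
import Algebra.Properties.Group as GroupProperties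
import Relation.Binary.Reasoning.Setoid as SetoidReasoning

¬¬-pull-Fin : ∀ {n} {P : Fin n → Set} → (∀ i → ¬ ¬ P i) → ¬ ¬ (∀ i → P i)
¬¬-pull-Fin {zero}      _   ¬∀P = ¬∀P (λ ())
¬¬-pull-Fin {suc n} {P} ¬¬P ¬∀P =
  ¬¬P zero λ P₀ → ¬¬-pull-Fin {P = λ i → P (suc i)} (λ i → ¬¬P (suc i)) λ P₊ →
    ¬∀P λ { zero → P₀ ; (suc i) → P₊ i }

distinct-pair : ∀ {n} → 2 ≤ n → Σ (Fin n) λ i → Σ (Fin n) λ j → i ≢ j
distinct-pair (s≤s (s≤s _)) = zero , suc zero , λ ()

module GroupLemmas (G : Group₀) where
  open Group G
  open GroupProperties G
  open GroupNotions G
  open SetoidReasoning setoid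

  _∩_ : Sub → Sub → Sub
  (H ∩ K) x = H x × K x

  SameSub-sym : ∀ {H K} → SameSub H K → SameSub K H
  SameSub-sym (H⊆K , K⊆H) = K⊆H , H⊆K

  SameSub-trans : ∀ {H K L} → SameSub H K → SameSub K L → SameSub H L
  SameSub-trans (H⊆K , K⊆H) (K⊆L , L⊆K) =
    (λ x hx → K⊆L x (H⊆K x hx)) , (λ x lx → K⊆H x (L⊆K x lx))

  uniqueMinimalNormal-unique : ∀ {N M} → UniqueMinimalNormal N → UniqueMinimalNormal M
                             → SameSub N M
  uniqueMinimalNormal-unique (N-minimal , _) (_ , M-unique) = M-unique _ N-minimal

  uniqueMinimalNormal⇒¬exactlyTwo : ∀ {N N₁ N₂} → UniqueMinimalNormal N
                                  → ¬ ExactlyTwoMinimalNormal N₁ N₂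
  uniqueMinimalNormal⇒¬exactlyTwo (_ , N-unique) (N₁-minimal , N₂-minimal , N₁≉N₂ , _) =
    N₁≉N₂ (SameSub-trans (N-unique _ N₁-minimal) (SameSub-sym (N-unique _ N₂-minimal)))

  ⊆-abelian : ∀ {H K} → H ⊆ K → AbelianSub K → AbelianSub H
  ⊆-abelian H⊆K K-abelian x y hx hy = K-abelian x y (H⊆K x hx) (H⊆K y hy)

  IsIsoOnto-resp : ∀ {A : Set} {_≈A_ : A → A → Set} {_·_ : A → A → A} {D : A → Set}
                     {ψ : A → Carrier} {H K : Sub}
                 → SameSub H K → IsIsoOnto _≈A_ _·_ D ψ H → IsIsoOnto _≈A_ _·_ D ψ K
  IsIsoOnto-resp (H⊆K , K⊆H) (ψ-cong , ψ-homo , ψ-injective , ψ-into , ψ-onto) =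
    ψ-cong , ψ-homo , ψ-injective ,
    (λ a da → H⊆K _ (ψ-into a da)) , (λ x kx → ψ-onto x (K⊆H x kx))

  g∙[g⁻¹∙x∙g]∙g⁻¹≈x : ∀ g x → g ∙ (g ⁻¹ ∙ x ∙ g) ∙ g ⁻¹ ≈ x
  g∙[g⁻¹∙x∙g]∙g⁻¹≈x g x = begin
    g ∙ (g ⁻¹ ∙ x ∙ g) ∙ g ⁻¹  ≈⟨ ∙-congʳ (assoc g (g ⁻¹ ∙ x) g) ⟨
    g ∙ (g ⁻¹ ∙ x) ∙ g ∙ g ⁻¹  ≈⟨ ∙-congʳ (∙-congʳ (\\-leftDividesˡ g x)) ⟩
    x ∙ g ∙ g ⁻¹               ≈⟨ //-rightDividesʳ g x ⟩
    x                          ∎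

  commutator≈ε⇒comm : ∀ x y → x ∙ y ∙ x ⁻¹ ∙ y ⁻¹ ≈ ε → x ∙ y ≈ y ∙ x
  commutator≈ε⇒comm x y [x,y]≈ε = begin
    x ∙ y             ≈⟨ //-rightDividesˡ x (x ∙ y) ⟨
    x ∙ y ∙ x ⁻¹ ∙ x  ≈⟨ ∙-congʳ (x∙y⁻¹≈ε⇒x≈y _ y [x,y]≈ε) ⟩
    y ∙ x             ∎

  trivial-meet⇒comm : ∀ {H K x y} → IsSubgroup H → IsSubgroup K → Trivial (H ∩ K)
                    → H x → H (y ∙ x ⁻¹ ∙ y ⁻¹) → K y → K (x ∙ y ∙ x ⁻¹)
                    → x ∙ y ≈ y ∙ x
  trivial-meet⇒comm {x = x} {y} (H-resp , _ , H-∙ , _) (_ , _ , K-∙ , K-⁻¹) H∩K-trivial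
                    hx hyx⁻¹y⁻¹ ky kxyx⁻¹ =
    commutator≈ε⇒comm x y (H∩K-trivial _ (H-resp _ _ reassoc (H-∙ _ _ hx hyx⁻¹y⁻¹) ,
                                            K-∙ _ _ kxyx⁻¹ (K-⁻¹ y ky)))
    where
    reassoc : x ∙ (y ∙ x ⁻¹ ∙ y ⁻¹) ≈ x ∙ y ∙ x ⁻¹ ∙ y ⁻¹
    reassoc = trans (sym (assoc x _ _)) (∙-congʳ (sym (assoc x y _)))

  Central : Sub
  Central z = ∀ t → z ∙ t ≈ t ∙ z

  central-resp : ∀ x y → x ≈ y → Central x → Central y
  central-resp x y x≈y central-x t =
    trans (∙-congʳ (sym x≈y)) (trans (central-x t) (∙-congˡ x≈y))

  central-isSubgroup : IsSubgroup Central
  central-isSubgroup = central-resp , central-ε , central-∙ , central-⁻¹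
    where
    central-ε : Central ε
    central-ε t = trans (identityˡ t) (sym (identityʳ t))

    central-∙ : ∀ x y → Central x → Central y → Central (x ∙ y)
    central-∙ x y central-x central-y t = begin
      x ∙ y ∙ t    ≈⟨ assoc x y t ⟩
      x ∙ (y ∙ t)  ≈⟨ ∙-congˡ (central-y t) ⟩
      x ∙ (t ∙ y)  ≈⟨ assoc x t y ⟨
      x ∙ t ∙ y    ≈⟨ ∙-congʳ (central-x t) ⟩
      t ∙ x ∙ y    ≈⟨ assoc t x y ⟩
      t ∙ (x ∙ y)  ∎

    central-⁻¹ : ∀ z → Central z → Central (z ⁻¹)
    central-⁻¹ z central-z t = begin
      z ⁻¹ ∙ t              ≈⟨ //-rightDividesʳ z (z ⁻¹ ∙ t) ⟨
      z ⁻¹ ∙ t ∙ z ∙ z ⁻¹   ≈⟨ ∙-congʳ (assoc (z ⁻¹) t z) ⟩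
      z ⁻¹ ∙ (t ∙ z) ∙ z ⁻¹ ≈⟨ ∙-congʳ (∙-congˡ (central-z t)) ⟨
      z ⁻¹ ∙ (z ∙ t) ∙ z ⁻¹ ≈⟨ ∙-congʳ (\\-leftDividesʳ z t) ⟩
      t ∙ z ⁻¹              ∎

  nonabelianSimple⇒central≈ε : NonabelianSimpleGroup G → ∀ z → Central z → z ≈ ε
  nonabelianSimple⇒central≈ε ((_ , _ , G-simple) , G-nonabelian) z central-z =
    [ (λ centre-trivial → centre-trivial z central-z)
    , (λ G⊆centre → ⊥-elim (G-nonabelian λ x y _ _ → G⊆centre x tt y))
    ]′ (G-simple Central central-isSubgroup (λ _ _ → tt) centre-normal)
    where
    centre-normal : ∀ x y → ⊤ → Central y → Central (x ∙ y ∙ x ⁻¹)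
    centre-normal x y _ central-y =
      central-resp _ _ (sym (trans (∙-congʳ (sym (central-y x))) (//-rightDividesʳ x y))) central-y

-- T, k and φ are kept, so Factor and InducesOnFactors are definitionally unchanged.
PowerStructure-resp : ∀ {G N M} → GroupNotions.SameSub G N M → PowerStructure G N → PowerStructure G M
PowerStructure-resp {G} N≈M P = record
  { T = T ; k = k ; T-nas = T-nas ; φ = φ ; φ-iso = GroupLemmas.IsIsoOnto-resp G N≈M φ-iso }
  where open PowerStructure P

module PowerStructureProperties {G : Group₀} {N : GroupNotions.Sub G} (P : PowerStructure G N) where
  open Group G
  open GroupProperties G using (identityʳ-unique; inverseˡ-unique)
  open GroupNotions G
  open GroupLemmas G
  open PowerStructure P
  open PowerStructureNotions P public using (Factor)
  module T where
    open Group T public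
    open GroupNotions T public using (IsSubgroup; Trivial; AbelianSub; SimpleSub)
  open SetoidReasoning setoid

  private
    T-simple : T.SimpleSub (Whole T)
    T-simple = proj₁ T-nas

    T-nontrivial : ¬ T.Trivial (Whole T)
    T-nontrivial = proj₁ (proj₂ T-simple)

    T-nonabelian : ¬ T.AbelianSub (Whole T)
    T-nonabelian = proj₂ T-nas

  εᵏ : Tup k
  εᵏ _ = T.ε

  _⁻¹ᵏ : Tup k → Tup k
  (a ⁻¹ᵏ) i = a i T.⁻¹

  φ-cong : ∀ {a b} → a ≈ᵏ b → φ a ≈ φ b
  φ-cong = proj₁ φ-iso _ _ tt tt

  φ-homo : ∀ a b → φ (a ·ᵏ b) ≈ φ a ∙ φ b
  φ-homo a b = proj₁ (proj₂ φ-iso) a b tt tt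

  φ-injective : ∀ {a b} → φ a ≈ φ b → a ≈ᵏ b
  φ-injective = proj₁ (proj₂ (proj₂ φ-iso)) _ _ tt tt

  φ-∈ : ∀ a → N (φ a)
  φ-∈ a = proj₁ (proj₂ (proj₂ (proj₂ φ-iso))) a tt

  φ-onto : ∀ {x} → N x → ∃[ a ] (φ a ≈ x)
  φ-onto nx with proj₂ (proj₂ (proj₂ (proj₂ φ-iso))) _ nx
  ... | a , _ , φa≈x = a , φa≈x

  φ-ε : φ εᵏ ≈ ε
  φ-ε = identityʳ-unique (φ εᵏ) (φ εᵏ)
          (trans (sym (φ-homo εᵏ εᵏ)) (φ-cong λ _ → T.identityˡ T.ε))

  φ-⁻¹ : ∀ a → φ (a ⁻¹ᵏ) ≈ φ a ⁻¹
  φ-⁻¹ a = inverseˡ-unique _ _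
             (trans (sym (φ-homo (a ⁻¹ᵏ) a)) (trans (φ-cong λ i → T.inverseˡ (a i)) φ-ε))

  δ-self : ∀ (i : Fin k) t → δ i t i ≡ t
  δ-self i t with i ≟ᶠ i
  ... | yes _   = ≡.refl
  ... | no  i≢i = contradiction ≡.refl i≢i

  δ-other : ∀ {i j : Fin k} t → i ≢ j → δ i t j ≡ T.ε
  δ-other {i} {j} t i≢j with i ≟ᶠ j
  ... | yes i≡j = contradiction i≡j i≢j
  ... | no  _   = ≡.refl

  δ-cong : ∀ (i : Fin k) {s t} → s T.≈ t → δ i s ≈ᵏ δ i t
  δ-cong i s≈t j with i ≟ᶠ j
  ... | yes _ = s≈t
  ... | no  _ = T.refl

  δ-homo : ∀ (i : Fin k) s t → δ i (s T.∙ t) ≈ᵏ (δ i s ·ᵏ δ i t)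
  δ-homo i s t j with i ≟ᶠ j
  ... | yes _ = T.refl
  ... | no  _ = T.sym (T.identityˡ T.ε)

  δ-ε : ∀ (i : Fin k) → δ i T.ε ≈ᵏ εᵏ
  δ-ε i j with i ≟ᶠ j
  ... | yes _ = T.refl
  ... | no  _ = T.refl

  δ-conj : ∀ (i : Fin k) t a → ((a ·ᵏ δ i t) ·ᵏ (a ⁻¹ᵏ)) ≈ᵏ δ i (a i T.∙ t T.∙ a i T.⁻¹)
  δ-conj i t a j with i ≟ᶠ j
  ... | yes ≡.refl = T.refl
  ... | no  _      = T.trans (T.∙-congʳ (T.identityʳ (a j))) (T.inverseʳ (a j))

  ι : Fin k → T.Carrier → Carrier
  ι i t = φ (δ i t)

  ι-cong : ∀ i {s t} → s T.≈ t → ι i s ≈ ι i t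
  ι-cong i s≈t = φ-cong (δ-cong i s≈t)

  ι-homo : ∀ i s t → ι i (s T.∙ t) ≈ ι i s ∙ ι i t
  ι-homo i s t = trans (φ-cong (δ-homo i s t)) (φ-homo _ _)

  ι-ε : ∀ i → ι i T.ε ≈ ε
  ι-ε i = trans (φ-cong (δ-ε i)) φ-ε

  ι-⁻¹ : ∀ i t → ι i (t T.⁻¹) ≈ ι i t ⁻¹
  ι-⁻¹ i t = inverseˡ-unique _ _
               (trans (sym (ι-homo i _ t)) (trans (ι-cong i (T.inverseˡ t)) (ι-ε i)))

  ι-injective : ∀ i {s t} → ι i s ≈ ι i t → s T.≈ t
  ι-injective i {s} {t} ιs≈ιt = subst₂ T._≈_ (δ-self i s) (δ-self i t) (φ-injective ιs≈ιt i)

  factor-ι : ∀ i t → Factor i (ι i t)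
  factor-ι i t = t , refl

  factor-resp : ∀ i {x y} → x ≈ y → Factor i x → Factor i y
  factor-resp i x≈y (t , ιt≈x) = t , trans ιt≈x x≈y

  factor-⁻¹ : ∀ i {x} → Factor i x → Factor i (x ⁻¹)
  factor-⁻¹ i (t , ιt≈x) = t T.⁻¹ , trans (ι-⁻¹ i t) (⁻¹-cong ιt≈x)

  factor-isSubgroup : ∀ i → IsSubgroup (Factor i)
  factor-isSubgroup i =
    (λ _ _ → factor-resp i) ,
    (T.ε , ι-ε i) ,
    (λ { _ _ (s , ιs≈x) (t , ιt≈y) → s T.∙ t , trans (ι-homo i s t) (∙-cong ιs≈x ιt≈y) }) ,
    (λ _ → factor-⁻¹ i)

  factor-⊆ : (∀ x y → x ≈ y → N x → N y) → ∀ i → Factor i ⊆ N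
  factor-⊆ N-resp i x (t , ιt≈x) = N-resp _ _ ιt≈x (φ-∈ _)

  factor-normal : ∀ i {x y} → N y → Factor i x → Factor i (y ∙ x ∙ y ⁻¹)
  factor-normal i {x} {y} ny (t , ιt≈x) with φ-onto ny
  ... | a , φa≈y = a i T.∙ t T.∙ a i T.⁻¹ , (begin
    ι i (a i T.∙ t T.∙ a i T.⁻¹)     ≈⟨ φ-cong (δ-conj i t a) ⟨
    φ ((a ·ᵏ δ i t) ·ᵏ (a ⁻¹ᵏ))      ≈⟨ φ-homo _ _ ⟩
    φ (a ·ᵏ δ i t) ∙ φ (a ⁻¹ᵏ)       ≈⟨ ∙-cong (φ-homo _ _) (φ-⁻¹ a) ⟩
    φ a ∙ ι i t ∙ φ a ⁻¹             ≈⟨ ∙-cong (∙-cong φa≈y ιt≈x) (⁻¹-cong φa≈y) ⟩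
    y ∙ x ∙ y ⁻¹                     ∎)

  factor-nontrivial : ∀ i → ¬ Trivial (Factor i)
  factor-nontrivial i Fᵢ-trivial =
    T-nontrivial λ t _ → ι-injective i (trans (Fᵢ-trivial _ (factor-ι i t)) (sym (ι-ε i)))

  factor-⊈ : ∀ {i j} → i ≢ j → ¬ (Factor i ⊆ Factor j)
  factor-⊈ {i} {j} i≢j Fᵢ⊆Fⱼ = T-nontrivial λ t _ → coordinateᵢ t (Fᵢ⊆Fⱼ _ (factor-ι i t))
    where
    coordinateᵢ : ∀ t → Factor j (ι i t) → t T.≈ T.ε
    coordinateᵢ t (s , ιⱼs≈ιᵢt) =
      subst₂ T._≈_ (δ-self i t) (δ-other s (λ j≡i → i≢j (≡.sym j≡i))) (T.sym (φ-injective ιⱼs≈ιᵢt i))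

  centralises-factors⇒≈ε : ∀ {x} → N x → (∀ j t → x ∙ ι j t ≈ ι j t ∙ x) → x ≈ ε
  centralises-factors⇒≈ε {x} nx x-centralises with φ-onto nx
  ... | a , φa≈x = trans (sym φa≈x) (trans (φ-cong a≈εᵏ) φ-ε)
    where
    φa-centralises : ∀ j t → φ (a ·ᵏ δ j t) ≈ φ (δ j t ·ᵏ a)
    φa-centralises j t = begin
      φ (a ·ᵏ δ j t)   ≈⟨ φ-homo a _ ⟩
      φ a ∙ ι j t      ≈⟨ ∙-congʳ φa≈x ⟩
      x ∙ ι j t        ≈⟨ x-centralises j t ⟩
      ι j t ∙ x        ≈⟨ ∙-congˡ φa≈x ⟨
      ι j t ∙ φ a      ≈⟨ φ-homo _ a ⟨
      φ (δ j t ·ᵏ a)   ∎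

    a≈εᵏ : a ≈ᵏ εᵏ
    a≈εᵏ j = GroupLemmas.nonabelianSimple⇒central≈ε T T-nas (a j) λ t →
      subst₂ (λ u v → a j T.∙ u T.≈ v T.∙ a j) (δ-self j t) (δ-self j t)
        (φ-injective (φa-centralises j t) j)

  ι-preimage-isSubgroup : ∀ {H} j → IsSubgroup H → T.IsSubgroup (λ t → H (ι j t))
  ι-preimage-isSubgroup j (H-resp , H-ε , H-∙ , H-⁻¹) =
    (λ s t s≈t → H-resp _ _ (ι-cong j s≈t)) ,
    H-resp _ _ (sym (ι-ε j)) H-ε ,
    (λ s t hs ht → H-resp _ _ (sym (ι-homo j s t)) (H-∙ _ _ hs ht)) ,
    (λ t ht → H-resp _ _ (sym (ι-⁻¹ j t)) (H-⁻¹ _ ht))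

  factor-⊆-or-∩-trivial : ∀ {H} j → IsSubgroup H → (∀ y z → N y → H z → H (y ∙ z ∙ y ⁻¹))
                        → Trivial (H ∩ Factor j) ⊎ Factor j ⊆ H
  factor-⊆-or-∩-trivial {H} j H-isSubgroup@(H-resp , _) H-normalised =
    [ (λ preimage-trivial → inj₁ λ { x (hx , t , ιt≈x) →
          trans (sym ιt≈x) (trans (ι-cong j (preimage-trivial t (H-resp _ _ (sym ιt≈x) hx))) (ι-ε j)) })
    , (λ T⊆preimage → inj₂ λ { x (t , ιt≈x) → H-resp _ _ ιt≈x (T⊆preimage t tt) })
    ]′ (proj₂ (proj₂ T-simple) _ (ι-preimage-isSubgroup j H-isSubgroup) (λ _ _ → tt) preimage-normal)
    where
    preimage-normal : ∀ s t → ⊤ → H (ι j t) → H (ι j (s T.∙ t T.∙ s T.⁻¹))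
    preimage-normal s t _ ht =
      H-resp _ _ (sym (trans (ι-homo j _ _) (∙-cong (ι-homo j s t) (ι-⁻¹ j s))))
        (H-normalised _ _ (φ-∈ _) ht)

  power⇒¬abelian : 1 ≤ k → ¬ AbelianSub N
  power⇒¬abelian 1≤k N-abelian = T-nonabelian λ s t _ _ → ι-injective i (begin
    ι i (s T.∙ t)    ≈⟨ ι-homo i s t ⟩
    ι i s ∙ ι i t    ≈⟨ N-abelian _ _ (φ-∈ _) (φ-∈ _) ⟩
    ι i t ∙ ι i s    ≈⟨ ι-homo i t s ⟨
    ι i (t T.∙ s)    ∎)
    where
    i : Fin k
    i = fromℕ< 1≤k

  power⇒¬simple : 2 ≤ k → ¬ SimpleSub N
  power⇒¬simple 2≤k ((N-resp , _) , _ , N-simple) with distinct-pair 2≤k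
  ... | i , j , i≢j =
    [ factor-nontrivial i
    , (λ N⊆Fᵢ → factor-⊈ (λ j≡i → i≢j (≡.sym j≡i)) λ x fx → N⊆Fᵢ x (factor-⊆ N-resp j x fx))
    ]′ (N-simple (Factor i) (factor-isSubgroup i) (factor-⊆ N-resp i) (λ _ _ ny → factor-normal i ny))

module FactorIntersections {G : Group₀} {N : GroupNotions.Sub G} (P Q : PowerStructure G N) where
  open Group G
  open GroupNotions G
  open GroupLemmas G
  open PowerStructureNotions using (InducesOnFactors)
  module P = PowerStructureProperties P
  module Q = PowerStructureProperties Q

  meets⇒⊇ : ∀ {i j} → ¬ Trivial (P.Factor i ∩ Q.Factor j) → Q.Factor j ⊆ P.Factor i
  meets⇒⊇ {i} {j} meets =
    [ (λ trivial → contradiction trivial meets) , (λ Fⱼ⊆Fᵢ → Fⱼ⊆Fᵢ) ]′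
      (Q.factor-⊆-or-∩-trivial j (P.factor-isSubgroup i) (λ _ _ ny → P.factor-normal i ny))

  -- A factor of P missing every factor of Q would centralise them all, hence lie in Z(N) = 1.
  factor-meets-some : ∀ i → ¬ (∀ j → Trivial (P.Factor i ∩ Q.Factor j))
  factor-meets-some i all-trivial = P.factor-nontrivial i λ { x (s , ιs≈x) → trans (sym ιs≈x) (ιs≈ε s) }
    where
    ιs≈ε : ∀ s → P.ι i s ≈ ε
    ιs≈ε s = Q.centralises-factors⇒≈ε (P.φ-∈ _) λ j t →
      trivial-meet⇒comm (P.factor-isSubgroup i) (Q.factor-isSubgroup j) (all-trivial j)
        (P.factor-ι i s) (P.factor-normal i (Q.φ-∈ _) (P.factor-⁻¹ i (P.factor-ι i s)))
        (Q.factor-ι j t) (Q.factor-normal j (P.φ-∈ _) (Q.factor-ι j t))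

  induced-⊆ : ∀ {σ τ} → InducesOnFactors P σ → InducesOnFactors Q τ
            → ∀ {i j} → P.Factor i ⊆ Q.Factor j
            → ∀ g → P.Factor (Action.act σ g i) ⊆ Q.Factor (Action.act τ g j)
  induced-⊆ {σ} {τ} σ-induced τ-induced {i} {j} Fᵢ⊆Fⱼ g x x∈F =
    Q.factor-resp (Action.act τ g j) (g∙[g⁻¹∙x∙g]∙g⁻¹≈x g x)
      (proj₁ (τ-induced g j _) (Fᵢ⊆Fⱼ _ (proj₂ (σ-induced g i x) x∈F)))

module FactorMatching {G : Group₀} {N : GroupNotions.Sub G} (P Q : PowerStructure G N) where
  open GroupNotions G
  open GroupLemmas G
  open PowerStructureNotions using (InducesOnFactors)
  module P = PowerStructureProperties P
  module Q = PowerStructureProperties Q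
  module PQ = FactorIntersections P Q
  module QP = FactorIntersections Q P

  SameFactor : Fin (PowerStructure.k P) → Fin (PowerStructure.k Q) → Set
  SameFactor i j = SameSub (P.Factor i) (Q.Factor j)

  -- Only up to double negation: triviality of an intersection is not decidable.
  ¬¬sameFactor : ∀ i → ¬ ¬ (∃[ j ] SameFactor i j)
  ¬¬sameFactor i no-match = ¬¬-pull-Fin ¬¬trivial (PQ.factor-meets-some i)
    where
    ¬¬trivial : ∀ j → ¬ ¬ Trivial (P.Factor i ∩ Q.Factor j)
    ¬¬trivial j meets =
      no-match (j , QP.meets⇒⊇ {j} {i} (λ trivial → meets λ { x (p , q) → trivial x (q , p) }) ,
                    PQ.meets⇒⊇ {i} {j} meets)

  sameFactor-unique : ∀ i {j j′} → SameFactor i j → SameFactor i j′ → j ≡ j′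
  sameFactor-unique i {j} {j′} (_ , Fⱼ⊆Fᵢ) (Fᵢ⊆Fⱼ′ , _) with j ≟ᶠ j′
  ... | yes j≡j′ = j≡j′
  ... | no  j≢j′ = contradiction (λ x fx → Fᵢ⊆Fⱼ′ x (Fⱼ⊆Fᵢ x fx)) (Q.factor-⊈ j≢j′)

  sameFactor-induced : ∀ {σ τ} → InducesOnFactors P σ → InducesOnFactors Q τ
                     → ∀ {i j} → SameFactor i j → ∀ g
                     → SameFactor (Action.act σ g i) (Action.act τ g j)
  sameFactor-induced {σ} {τ} σ-induced τ-induced {i} {j} (Fᵢ⊆Fⱼ , Fⱼ⊆Fᵢ) g =
    PQ.induced-⊆ {σ} {τ} σ-induced τ-induced {i} {j} Fᵢ⊆Fⱼ g ,
    QP.induced-⊆ {τ} {σ} τ-induced σ-induced {j} {i} Fⱼ⊆Fᵢ g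

fibre : ∀ {k ℓ} → (Fin k → Fin ℓ) → Fin ℓ → Subset k
fibre h c = tabulate (λ i → does (h i ≟ᶠ c))

∈-fibre⁺ : ∀ {k ℓ} (h : Fin k → Fin ℓ) {c i} → h i ≡ c → i ∈ fibre h c
∈-fibre⁺ h {c} {i} hi≡c =
  lookup⇒[]= i _ (≡.trans (lookup∘tabulate _ i) (dec-true (h i ≟ᶠ c) hi≡c))

∈-fibre⁻ : ∀ {k ℓ} (h : Fin k → Fin ℓ) {c i} → i ∈ fibre h c → h i ≡ c
∈-fibre⁻ h {c} {i} i∈fibre = toWitness (Equivalence.from T-≡
  (≡.trans (isYes≗does (h i ≟ᶠ c)) (≡.trans (≡.sym (lookup∘tabulate _ i)) ([]=⇒lookup i∈fibre))))

1≤∣p∣⇒nonempty : ∀ {n} {p : Subset n} → 1 ≤ ∣ p ∣ → Nonempty p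
1≤∣p∣⇒nonempty {n} {p} 1≤∣p∣ with nonempty? p
... | yes p-nonempty = p-nonempty
... | no  p-empty    =
  contradiction (subst (1 ≤_) (∣⊥∣≡0 n) (subst (λ q → 1 ≤ ∣ q ∣) (Empty-unique p-empty) 1≤∣p∣)) λ ()

⊆⁅x⁆⇒∣p∣≤1 : ∀ {n} {p : Subset n} {x} → (∀ {y} → y ∈ p → y ≡ x) → ∣ p ∣ ≤ 1
⊆⁅x⁆⇒∣p∣≤1 {x = x} p⊆⁅x⁆ =
  subst (_ ≤_) (∣⁅x⁆∣≡1 x) (p⊆q⇒∣p∣≤∣q∣ λ y∈p → subst (_∈ ⁅ x ⁆) (≡.sym (p⊆⁅x⁆ y∈p)) (x∈⁅x⁆ x))

∣p∣≤1⇒subsingleton : ∀ {n} {p : Subset n} → ∣ p ∣ ≤ 1 → ∀ {x y} → x ∈ p → y ∈ p → x ≡ y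
∣p∣≤1⇒subsingleton {p = p} ∣p∣≤1 {x} {y} x∈p y∈p with y ≟ᶠ x
... | yes y≡x = ≡.sym y≡x
... | no  y≢x = contradiction (≤-trans 2≤∣p∣ ∣p∣≤1) λ { (s≤s ()) }
  where
  ⁅x⁆⊂p : ⁅ x ⁆ ⊂ p
  ⁅x⁆⊂p = (λ z∈⁅x⁆ → subst (_∈ p) (≡.sym (x∈⁅y⁆⇒x≡y x z∈⁅x⁆)) x∈p) , y , y∈p , x≢y⇒x∉⁅y⁆ y≢x

  2≤∣p∣ : 2 ≤ ∣ p ∣
  2≤∣p∣ = subst (λ s → suc s ≤ ∣ p ∣) (∣⁅x⁆∣≡1 x) (p⊂q⇒∣p∣<∣q∣ ⁅x⁆⊂p)

module _ {G : Group₀} {k : ℕ} (σ : Action G k) where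
  open Action σ
  open ActionNotions σ

  PreservesFibres : ∀ {ℓ} → (Fin k → Fin ℓ) → Set
  PreservesFibres h = ∀ g c → ∃[ c′ ] (∀ i → h i ≡ c → h (act g i) ≡ c′)

  fibre-isBlock : ∀ {ℓ} {h : Fin k → Fin ℓ} → PreservesFibres h → ∀ c → IsBlock (fibre h c)
  fibre-isBlock {h = h} h-preserves c g with h-preserves g c
  ... | c′ , c↦c′ with c′ ≟ᶠ c
  ...   | yes c′≡c = inj₁ λ i i∈ → ∈-fibre⁺ h (≡.trans (c↦c′ i (∈-fibre⁻ h i∈)) c′≡c)
  ...   | no  c′≢c = inj₂ λ i i∈ gi∈ →
    c′≢c (≡.trans (≡.sym (c↦c′ i (∈-fibre⁻ h i∈))) (∈-fibre⁻ h gi∈))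

preservesFibres-∘ : ∀ {G k k′ ℓ} (σ : Action G k) (τ : Action G k′) {f : Fin k → Fin k′}
                      {h : Fin k′ → Fin ℓ}
                  → (∀ g i → f (Action.act σ g i) ≡ Action.act τ g (f i))
                  → PreservesFibres τ h → PreservesFibres σ (λ i → h (f i))
preservesFibres-∘ σ τ {h = h} f-equivariant h-preserves g c =
  proj₁ (h-preserves g c) , λ i hfi≡c →
    ≡.trans (≡.cong h (f-equivariant g i)) (proj₂ (h-preserves g c) _ hfi≡c)

-- The fibre B of h ∘ f over c₀ is a block of σ. It has two points, as f maps it onto
-- fibre h c₀, and it is not everything, as it misses the preimages of fibre h c₁.
primitive-cover⇒¬partition
  : ∀ {G k k′ ℓ} (σ : Action G k) (τ : Action G k′) → ActionNotions.Primitive σ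
  → (f : Fin k → Fin k′) → (∀ g i → f (Action.act σ g i) ≡ Action.act τ g (f i))
  → (∀ j → ∃[ i ] (f i ≡ j))
  → (h : Fin k′ → Fin ℓ) → PreservesFibres τ h → 2 ≤ ℓ → (∀ c → 2 ≤ ∣ fibre h c ∣) → ⊥
primitive-cover⇒¬partition {k = k} {k′} {ℓ} σ τ (_ , σ-blocks) f f-equivariant f-surjective
                           h h-preserves 2≤ℓ 2≤∣fibre∣
  with distinct-pair 2≤ℓ
... | c₀ , c₁ , c₀≢c₁ =
  [ (λ ∣B∣≤1 → contradiction (≤-trans (2≤∣fibre∣ c₀) (⊆⁅x⁆⇒∣p∣≤1 (F₀-collapses ∣B∣≤1))) λ { (s≤s ()) })
  , (λ ∣B∣≡k → c₀≢c₁ (≡.trans (≡.sym (∈-fibre⁻ h∘f (B-full ∣B∣≡k (preimage j₁))))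
                              (≡.trans (≡.cong h (f∘preimage j₁)) (∈-fibre⁻ h j₁∈F₁))))
  ]′ (σ-blocks B (fibre-isBlock σ (preservesFibres-∘ σ τ f-equivariant h-preserves) c₀))
  where
  h∘f : Fin k → Fin ℓ
  h∘f i = h (f i)

  B : Subset k
  B = fibre h∘f c₀

  preimage : Fin k′ → Fin k
  preimage j = proj₁ (f-surjective j)

  f∘preimage : ∀ j → f (preimage j) ≡ j
  f∘preimage j = proj₂ (f-surjective j)

  preimage-∈B : ∀ {j} → j ∈ fibre h c₀ → preimage j ∈ B
  preimage-∈B {j} j∈F₀ = ∈-fibre⁺ h∘f (≡.trans (≡.cong h (f∘preimage j)) (∈-fibre⁻ h j∈F₀))

  fibre-nonempty : ∀ c → Nonempty (fibre h c)
  fibre-nonempty c = 1≤∣p∣⇒nonempty (<⇒≤ (2≤∣fibre∣ c))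

  j₀ j₁ : Fin k′
  j₀ = proj₁ (fibre-nonempty c₀)
  j₁ = proj₁ (fibre-nonempty c₁)

  j₁∈F₁ : j₁ ∈ fibre h c₁
  j₁∈F₁ = proj₂ (fibre-nonempty c₁)

  F₀-collapses : ∣ B ∣ ≤ 1 → ∀ {j} → j ∈ fibre h c₀ → j ≡ j₀
  F₀-collapses ∣B∣≤1 {j} j∈F₀ = begin
    j                ≡⟨ f∘preimage j ⟨
    f (preimage j)   ≡⟨ ≡.cong f (∣p∣≤1⇒subsingleton ∣B∣≤1 (preimage-∈B j∈F₀)
                                    (preimage-∈B (proj₂ (fibre-nonempty c₀)))) ⟩
    f (preimage j₀)  ≡⟨ f∘preimage j₀ ⟩
    j₀               ∎
    where open ≡.≡-Reasoning

  B-full : ∣ B ∣ ≡ k → ∀ i → i ∈ B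
  B-full ∣B∣≡k i = subst (i ∈_) (≡.sym (∣p∣≡n⇒p≡⊤ ∣B∣≡k)) ∈⊤

primitive-factor-action⇒¬partition
  : ∀ {G N ℓ} (P Q : PowerStructure G N)
      (σ : Action G (PowerStructure.k P)) (τ : Action G (PowerStructure.k Q))
  → PowerStructureNotions.InducesOnFactors P σ → PowerStructureNotions.InducesOnFactors Q τ
  → ActionNotions.Primitive σ
  → (h : Fin (PowerStructure.k Q) → Fin ℓ) → PreservesFibres τ h → 2 ≤ ℓ
  → (∀ c → 2 ≤ ∣ fibre h c ∣) → ⊥
primitive-factor-action⇒¬partition {G} P Q σ τ σ-induced τ-induced σ-primitive h h-preserves 2≤ℓ 2≤∣fibre∣ =
  ¬¬-pull-Fin PQ.¬¬sameFactor λ match →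
  ¬¬-pull-Fin QP.¬¬sameFactor λ comatch →
  primitive-cover⇒¬partition σ τ σ-primitive (λ i → proj₁ (match i))
    (λ g i → PQ.sameFactor-unique (Action.act σ g i) (proj₂ (match (Action.act σ g i)))
               (PQ.sameFactor-induced {σ} {τ} σ-induced τ-induced {i} (proj₂ (match i)) g))
    (λ j → proj₁ (comatch j) ,
           PQ.sameFactor-unique (proj₁ (comatch j)) (proj₂ (match (proj₁ (comatch j))))
             (GroupLemmas.SameSub-sym G (proj₂ (comatch j))))
    h h-preserves 2≤ℓ 2≤∣fibre∣
  where
  module PQ = FactorMatching P Q
  module QP = FactorMatching Q P

typeSD⇒¬typeCD : ∀ {G n₁ n₂} (A₁ : Action G n₁) (A₂ : Action G n₂) → TypeSD A₁ → ¬ TypeCD A₂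
typeSD⇒¬typeCD {G} _ _
  (N , N-unique , P , _ , _ , _ , σ , σ-induced , σ-primitive)
  (M , M-unique , Q , _ , _ , 2≤ℓ , 2≤m , _ , _ , _ , supp , _ , _ , ∣fibre∣≡m , _ , _ , τ , τ-induced , supp-preserved) =
  primitive-factor-action⇒¬partition P (PowerStructure-resp M≈N Q) σ τ σ-induced τ-induced σ-primitive
    supp supp-preserved 2≤ℓ (λ c → subst (2 ≤_) (≡.sym (∣fibre∣≡m c)) 2≤m)
  where
  M≈N : GroupNotions.SameSub G M N
  M≈N = GroupLemmas.SameSub-sym G (GroupLemmas.uniqueMinimalNormal-unique G N-unique M-unique)

data Kind : Set where
  abelian simple power : Kind

data HasKind (G : Group₀) (N : GroupNotions.Sub G) : Kind → Set₁ where
  abelian : GroupNotions.AbelianSub G N → HasKind G N abelian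
  simple  : GroupNotions.NonabelianSimpleSub G N → HasKind G N simple
  power   : (P : PowerStructure G N) → 2 ≤ PowerStructure.k P → HasKind G N power

data SocleShape : Set where
  one two : Kind → SocleShape

data Socle (G : Group₀) : SocleShape → Set₁ where
  one : ∀ {N κ} → GroupNotions.UniqueMinimalNormal G N → HasKind G N κ → Socle G (one κ)
  two : ∀ {N₁ N₂ κ} → GroupNotions.ExactlyTwoMinimalNormal G N₁ N₂
      → HasKind G N₁ κ → HasKind G N₂ κ → Socle G (two κ)

module _ {G : Group₀} where
  open GroupNotions G
  open GroupLemmas G

  kind-unique : ∀ {N M κ κ′} → SameSub N M → HasKind G N κ → HasKind G M κ′ → κ ≡ κ′
  kind-unique _         (abelian _)        (abelian _)             = ≡.refl
  kind-unique (_ , M⊆N) (abelian N-abelian) (simple (_ , M-nonabelian)) =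
    ⊥-elim (M-nonabelian (⊆-abelian M⊆N N-abelian))
  kind-unique (_ , M⊆N) (abelian N-abelian) (power P 2≤k)           =
    ⊥-elim (PowerStructureProperties.power⇒¬abelian P (<⇒≤ 2≤k) (⊆-abelian M⊆N N-abelian))
  kind-unique (N⊆M , _) (simple (_ , N-nonabelian)) (abelian M-abelian) =
    ⊥-elim (N-nonabelian (⊆-abelian N⊆M M-abelian))
  kind-unique _         (simple _)         (simple _)              = ≡.refl
  kind-unique N≈M       (simple (N-simple , _)) (power P 2≤k)      =
    ⊥-elim (PowerStructureProperties.power⇒¬simple (PowerStructure-resp (SameSub-sym N≈M) P) 2≤k N-simple)
  kind-unique (N⊆M , _) (power P 2≤k)      (abelian M-abelian)     =
    ⊥-elim (PowerStructureProperties.power⇒¬abelian P (<⇒≤ 2≤k) (⊆-abelian N⊆M M-abelian))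
  kind-unique N≈M       (power P 2≤k)      (simple (M-simple , _)) =
    ⊥-elim (PowerStructureProperties.power⇒¬simple (PowerStructure-resp N≈M P) 2≤k M-simple)
  kind-unique _         (power _ _)        (power _ _)             = ≡.refl

  socle-shape-unique : ∀ {s s′} → Socle G s → Socle G s′ → s ≡ s′
  socle-shape-unique (one N-unique N-kind) (one M-unique M-kind) =
    ≡.cong one (kind-unique (uniqueMinimalNormal-unique N-unique M-unique) N-kind M-kind)
  socle-shape-unique (one N-unique _) (two M₁M₂ _ _) = ⊥-elim (uniqueMinimalNormal⇒¬exactlyTwo N-unique M₁M₂)
  socle-shape-unique (two N₁N₂ _ _) (one M-unique _) = ⊥-elim (uniqueMinimalNormal⇒¬exactlyTwo M-unique N₁N₂)
  socle-shape-unique (two (N₁-minimal , _) N₁-kind _) (two (_ , _ , _ , M-minimals) M₁-kind M₂-kind)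
    with M-minimals _ N₁-minimal
  ... | inj₁ N₁≈M₁ = ≡.cong two (kind-unique N₁≈M₁ N₁-kind M₁-kind)
  ... | inj₂ N₁≈M₂ = ≡.cong two (kind-unique N₁≈M₂ N₁-kind M₂-kind)

shape : ONType → SocleShape
shape HA = one abelian
shape HS = two simple
shape HC = two power
shape AS = one simple
shape TW = one power
shape SD = one power
shape CD = one power
shape PA = one power

socle : ∀ {G n} (A : Action G n) t → HasType A t → Socle G (shape t)
socle A HA (_ , N-unique , (N-abelian , _) , _) = one N-unique (abelian N-abelian)
socle A HS (_ , _ , N₁N₂ , N₁-simple , _ , N₂-simple , _) = two N₁N₂ (simple N₁-simple) (simple N₂-simple)
socle A HC (_ , _ , N₁N₂ , (P₁ , 2≤k₁) , _ , (P₂ , 2≤k₂) , _) = two N₁N₂ (power P₁ 2≤k₁) (power P₂ 2≤k₂)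
socle A AS (_ , N-unique , N-simple) = one N-unique (simple N-simple)
socle A TW (_ , N-unique , _ , P , 6≤k) = one N-unique (power P (≤-trans (s≤s (s≤s z≤n)) 6≤k))
socle A SD (_ , N-unique , P , 2≤k , _) = one N-unique (power P 2≤k)
socle A CD (_ , N-unique , P , _ , _ , 2≤ℓ , 2≤m , ℓm≡k , _) =
  one N-unique (power P (subst (2 ≤_) ℓm≡k (≤-trans (s≤s (s≤s z≤n)) (*-mono-≤ 2≤ℓ 2≤m))))
socle A PA (_ , N-unique , P , 2≤k , _) = one N-unique (power P 2≤k)

representative : SocleShape → ONType
representative (one abelian) = HA
representative (one simple)  = AS
representative (one power)   = TW
representative (two power)   = HC
representative (two _)       = HS   -- also for two abelian, which is no type's shape

representative-shape : ∀ t → shape t ≢ one power → representative (shape t) ≡ t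
representative-shape HA _     = ≡.refl
representative-shape HS _     = ≡.refl
representative-shape HC _     = ≡.refl
representative-shape AS _     = ≡.refl
representative-shape TW ¬power = contradiction ≡.refl ¬power
representative-shape SD ¬power = contradiction ≡.refl ¬power
representative-shape CD ¬power = contradiction ≡.refl ¬power
representative-shape PA ¬power = contradiction ≡.refl ¬power

shape-injective : ∀ {t t′} → shape t ≡ shape t′ → shape t ≢ one power → t ≡ t′
shape-injective {t} {t′} t~t′ ¬power =
  ≡.trans (≡.sym (representative-shape t ¬power))
    (≡.trans (≡.cong representative t~t′) (representative-shape t′ λ power → ¬power (≡.trans t~t′ power)))

shape≡one-power : ∀ t → shape t ≡ one power → t ≡ TW ⊎ t ≡ SD ⊎ t ≡ CD ⊎ t ≡ PA
shape≡one-power TW _ = inj₁ ≡.refl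
shape≡one-power SD _ = inj₂ (inj₁ ≡.refl)
shape≡one-power CD _ = inj₂ (inj₂ (inj₁ ≡.refl))
shape≡one-power PA _ = inj₂ (inj₂ (inj₂ ≡.refl))
shape≡one-power HA ()
shape≡one-power HS ()
shape≡one-power HC ()
shape≡one-power AS ()

compatible-of-shape : ∀ t₁ t₂ → shape t₁ ≡ shape t₂
                    → ¬ (t₁ ≡ SD × t₂ ≡ CD) → ¬ (t₂ ≡ SD × t₁ ≡ CD) → Compatible t₁ t₂
compatible-of-shape HA _ same _ _ = ≡.sym (shape-injective same λ ())
compatible-of-shape HS _ same _ _ = ≡.sym (shape-injective same λ ())
compatible-of-shape HC _ same _ _ = ≡.sym (shape-injective same λ ())
compatible-of-shape AS _ same _ _ = ≡.sym (shape-injective same λ ())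
compatible-of-shape TW t₂ same _ _ = shape≡one-power t₂ (≡.sym same)
compatible-of-shape PA t₂ same _ _ = shape≡one-power t₂ (≡.sym same)
compatible-of-shape SD t₂ same ¬SD-CD _ with shape≡one-power t₂ (≡.sym same)
... | inj₁ t₂≡TW               = inj₁ t₂≡TW
... | inj₂ (inj₁ t₂≡SD)        = inj₂ (inj₁ t₂≡SD)
... | inj₂ (inj₂ (inj₁ t₂≡CD)) = contradiction (≡.refl , t₂≡CD) ¬SD-CD
... | inj₂ (inj₂ (inj₂ t₂≡PA)) = inj₂ (inj₂ t₂≡PA)
compatible-of-shape CD t₂ same _ ¬SD-CD with shape≡one-power t₂ (≡.sym same)
... | inj₁ t₂≡TW               = inj₁ t₂≡TW
... | inj₂ (inj₁ t₂≡SD)        = contradiction (t₂≡SD , ≡.refl) ¬SD-CD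
... | inj₂ (inj₂ (inj₁ t₂≡CD)) = inj₂ (inj₁ t₂≡CD)
... | inj₂ (inj₂ (inj₂ t₂≡PA)) = inj₂ (inj₂ t₂≡PA)

SD-CD-exclusive : ∀ {G n₁ n₂} (A₁ : Action G n₁) (A₂ : Action G n₂) {t₁ t₂}
                → HasType A₁ t₁ → HasType A₂ t₂ → ¬ (t₁ ≡ SD × t₂ ≡ CD)
SD-CD-exclusive A₁ A₂ sd cd (≡.refl , ≡.refl) = typeSD⇒¬typeCD A₁ A₂ sd cd

lemma2p6 : (G : Group₀) → GroupNotions.IsFiniteGroup G
         → (n₁ n₂ : ℕ) (A₁ : Action G n₁) (A₂ : Action G n₂)
         → ActionNotions.Faithful A₁ → ActionNotions.Primitive A₁
         → ActionNotions.Faithful A₂ → ActionNotions.Primitive A₂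
         → (t₁ t₂ : ONType) → HasType A₁ t₁ → HasType A₂ t₂
         → Compatible t₁ t₂
lemma2p6 G _ _ _ A₁ A₂ _ _ _ _ t₁ t₂ h₁ h₂ =
  compatible-of-shape t₁ t₂
    (socle-shape-unique (socle A₁ t₁ h₁) (socle A₂ t₂ h₂))
    (SD-CD-exclusive A₁ A₂ h₁ h₂)
    (SD-CD-exclusive A₂ A₁ h₂ h₁)
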